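{- Let $n\geq 2$ and let $G$ be the rook's graph $K_2\square K_n$. Then $\mathrm{mfi}(G)=\frac{n(n-1)}{2}$.
   Context: The rook's graph $K_m\square K_n$ has vertex set $\{v_{r,c}: 1\le r\le m, 1\le c\le n\}$, with $v_{r,c}\sim v_{r',c'}$ iff exactly one of $r=r'$, $c=c'$ holds. A triangulation of $G=(V,E)$ is a chordal graph $H$ on $V$ with $E\subseteq E_H$. The minimum fill-in $\mathrm{mfi}(G)$ is the minimum of $|E_H|-|E|$ over all triangulations $H$ of $G$. -}

module Defs where

open import Data.Nat using (ℕ; zero; suc; _+_; _*_; _∸_; _≤_; _/_; _%_)
open import Data.Nat.Properties using ()
open import Data.Fin using (Fin; toℕ)
open import Data.Bool using (Bool; true; false; _∧_; _∨_; not; if_then_else_)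
open import Data.Fin.Properties using (_≟_)
open import Data.List using (List; length; filter; map; concatMap; cartesianProduct)
open import Data.Product using (_×_; _,_; Σ; ∃; ∃-syntax; proj₁; proj₂)
open import Relation.Nullary using (¬_; does; yes; no)
open import Data.Empty using (⊥-elim)
open import Relation.Binary.PropositionalEquality using (_≡_; _≢_; refl) renaming (sym to sym≡)
open import Function.Definitions using (Injective)
open import Data.List.Relation.Unary.All using (All)

record Graph (V : Set) : Set where
  field
    adj    : V → V → Bool
    sym    : ∀ u v → adj u v ≡ adj v u
    irrefl : ∀ v → adj v v ≡ false
open Graph public

-- Vertices of K_m □ K_n: pairs (r , c) with r : Fin m (row), c : Fin n (column).
Cell : ℕ → ℕ → Set
Cell m n = Fin m × Fin n

rookAdj : ∀ {m n} → Cell m n → Cell m n → Bool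
rookAdj (r , c) (r' , c') =
  let er = does (r ≟ r') ; ec = does (c ≟ c') in
  (er ∧ not ec) ∨ (not er ∧ ec)


cells : (m n : ℕ) → List (Cell m n)
cells m n = cartesianProduct (Data.List.tabulate {n = m} (λ i → i)) (Data.List.tabulate {n = n} (λ j → j))
  where import Data.List

-- Number of edges of a graph on Cell m n: (number of ordered adjacent pairs) / 2.
-- Since adjacency is symmetric and irreflexive this is exactly |E|.
edgeCount : ∀ {m n} → Graph (Cell m n) → ℕ
edgeCount {m} {n} G =
  length (filter (λ p → adj G (proj₁ p) (proj₂ p) Data.Bool.≟ true)
                 (cartesianProduct (cells m n) (cells m n))) / 2
  where import Data.Bool

-- Cycles: a cycle of length k + 4 (so length ≥ 4) is an injective map
-- c : Fin (k + 4) → V with c i adjacent to c (i+1 mod (k+4)).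
-- Index j follows index i cyclically:
Next : (l : ℕ) → .{{_ : Data.Nat.NonZero l}} → ℕ → ℕ → Set
Next l i j = suc i % l ≡ j
  where import Data.Nat

record Cycle {V : Set} (H : Graph V) (k : ℕ) : Set where
  field
    vert  : Fin (suc (suc (suc (suc k)))) → V
    inj   : Injective _≡_ _≡_ vert
    edges : ∀ i j → Next (suc (suc (suc (suc k)))) (toℕ i) (toℕ j) → adj H (vert i) (vert j) ≡ true
open Cycle public

HasChord : ∀ {V} {H : Graph V} {k} → Cycle H k → Set
HasChord {H = H} {k} C =
  ∃[ i ] ∃[ j ] (i ≢ j
    × ¬ Next (suc (suc (suc (suc k)))) (toℕ i) (toℕ j)
    × ¬ Next (suc (suc (suc (suc k)))) (toℕ j) (toℕ i)
    × adj H (vert C i) (vert C j) ≡ true)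

Chordal : ∀ {V} → Graph V → Set
Chordal H = ∀ k (C : Cycle H k) → HasChord C

IsTriangulation : ∀ {V} → Graph V → Graph V → Set
IsTriangulation G H = (∀ u v → adj G u v ≡ true → adj H u v ≡ true) × Chordal H

fill : ∀ {m n} → Graph (Cell m n) → Graph (Cell m n) → ℕ
fill G H = edgeCount H ∸ edgeCount G

MinFillIn : ∀ {m n} → Graph (Cell m n) → ℕ → Set
MinFillIn G k =
  (∃[ H ] (IsTriangulation G H × fill G H ≡ k))
  × (∀ H → IsTriangulation G H → k ≤ fill G H)

private
  eqSym : ∀ {k} (a b : Fin k) → does (a ≟ b) ≡ does (b ≟ a)
  eqSym a b with a ≟ b | b ≟ a
  ... | yes _ | yes _ = refl
  ... | no _ | no _ = refl
  ... | yes p | no q = ⊥-elim (q (sym≡ p))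
  ... | no p | yes q = ⊥-elim (p (sym≡ q))

  eqRefl : ∀ {k} (a : Fin k) → does (a ≟ a) ≡ true
  eqRefl a with a ≟ a
  ... | yes _ = refl
  ... | no p = ⊥-elim (p refl)

rook : (m n : ℕ) → Graph (Cell m n)
adj    (rook m n) = rookAdj
sym    (rook m n) (r , c) (r' , c') rewrite eqSym r r' | eqSym c c' = refl
irrefl (rook m n) (r , c) rewrite eqRefl r | eqRefl c = refl

-- The staircase graph on the 2 × n grid — both rows cliques, and (0, a) joined to (1, b) exactly when
-- a ≤ b — is chordal, since listing row 1 left to right and then row 0 is a perfect elimination order,
-- and it adds one edge for each pair of columns. Conversely, for columns a ≠ b the vertices
-- (0,a) (0,b) (1,b) (1,a) form a 4-cycle of the rook's graph, so every triangulation contains one of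
-- its two diagonals, again one new edge per pair of columns.
module Submission where

open import Defs hiding (sym)
open import Data.Bool as Bool using (Bool; true; false; not; if_then_else_)
open import Data.Bool.Properties using (∨-identityʳ)
open import Data.Fin using (Fin; zero; suc; toℕ; fromℕ<)
open import Data.Fin.Patterns using (0F; 1F; 2F; 3F)
open import Data.Fin.Properties as Fin using (_≟_; _≤?_; toℕ<n; toℕ-fromℕ<)
open import Data.List using ([]; _∷_; length; filter; map; tabulate; cartesianProduct; allFin; _++_)
open import Data.List.Extrema.Nat using (argmin; f[argmin]≤f[xs])
open import Data.List.Membership.Propositional.Properties using (∈-allFin)
open import Data.List.Properties using (map-++; map-∘)
import Data.List.Relation.Unary.All as All
open import Data.Nat using (ℕ; zero; suc; _+_; _*_; _∸_; _≤_; _<_; _/_; z≤n; s≤s)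
open import Data.Nat.DivMod using (n%n≡0; m<n⇒m%n≡m; m*n/n≡m; +-distrib-/-∣ˡ; /-monoˡ-≤)
open import Data.Nat.Divisibility using (divides-refl)
import Data.Nat.ListAction as ListAction
open import Data.Nat.ListAction.Properties using (sum-++)
open import Data.Nat.Properties
  using ( +-0-commutativeMonoid; +-mono-≤; ≤-refl; ≤-trans; ≤-pred; n≤1+n; <⇒≤; <⇒≱; <-≤-trans
        ; m≤m+n; m≤n⇒m<n∨m≡n; m≢1+n+m; 1+n≢n; *-assoc; *-identityʳ; *-distribˡ-+; m+n∸m≡n
        ; ∸-monoˡ-≤; module ≤-Reasoning)
open import Algebra.Properties.CommutativeMonoid.Sum +-0-commutativeMonoid
  using (sum; sum-syntax; sum-cong-≗; ∑-distrib-+; ∑-comm)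
open import Data.Product using (_×_; _,_; proj₁; proj₂; ∃-syntax; ∃₂)
open import Data.Sum as Sum using (_⊎_; inj₁; inj₂)
open import Function using (_∘_)
open import Function.Definitions using (Injective)
open import Relation.Binary.Definitions using (tri<; tri≈; tri>)
open import Relation.Binary.PropositionalEquality
  using (_≡_; _≢_; refl; sym; trans; cong; cong₂; subst₂; module ≡-Reasoning)
open import Relation.Nullary using (¬_; Dec; yes; no; does; contradiction)
open import Relation.Nullary.Decidable using (dec-true; dec-false)

does≡true⇒ : ∀ {P : Set} (P? : Dec P) → does P? ≡ true → P
does≡true⇒ (yes p) _ = p

does-≟-comm : ∀ {n} (a b : Fin n) → does (a ≟ b) ≡ does (b ≟ a)
does-≟-comm a b with a ≟ b | b ≟ a
... | yes _   | yes _   = refl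
... | no _    | no _    = refl
... | yes a≡b | no b≢a  = contradiction (sym a≡b) b≢a
... | no a≢b  | yes b≡a = contradiction (sym b≡a) a≢b

𝟙 : Bool → ℕ
𝟙 true  = 1
𝟙 false = 0

∑-const : ∀ n c → ∑[ i < n ] c ≡ n * c
∑-const zero    c = refl
∑-const (suc n) c = cong (c +_) (∑-const n c)

∑-mono-≤ : ∀ {n} {f g : Fin n → ℕ} → (∀ i → f i ≤ g i) → sum f ≤ sum g
∑-mono-≤ {zero}  _   = z≤n
∑-mono-≤ {suc n} f≤g = +-mono-≤ (f≤g zero) (∑-mono-≤ (f≤g ∘ suc))

[m*2+n]/2≡m+n/2 : ∀ m n → (m * 2 + n) / 2 ≡ m + n / 2
[m*2+n]/2≡m+n/2 m n = trans (+-distrib-/-∣ˡ n (divides-refl m)) (cong (_+ n / 2) (m*n/n≡m m 2))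

length-filter≡sum-𝟙 : ∀ {A : Set} (f : A → Bool) xs →
  length (filter (λ x → f x Bool.≟ true) xs) ≡ ListAction.sum (map (𝟙 ∘ f) xs)
length-filter≡sum-𝟙 f [] = refl
length-filter≡sum-𝟙 f (x ∷ xs) with f x
... | true  = cong suc (length-filter≡sum-𝟙 f xs)
... | false = length-filter≡sum-𝟙 f xs

sum-map-cartesianProduct : ∀ {A B : Set} (g : A × B → ℕ) xs ys →
  ListAction.sum (map g (cartesianProduct xs ys))
    ≡ ListAction.sum (map (λ x → ListAction.sum (map (λ y → g (x , y)) ys)) xs)
sum-map-cartesianProduct g [] ys = refl
sum-map-cartesianProduct g (x ∷ xs) ys = begin
  ListAction.sum (map g (map (x ,_) ys ++ cartesianProduct xs ys))
    ≡⟨ cong ListAction.sum (map-++ g (map (x ,_) ys) _) ⟩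
  ListAction.sum (map g (map (x ,_) ys) ++ map g (cartesianProduct xs ys))
    ≡⟨ sum-++ (map g (map (x ,_) ys)) _ ⟩
  ListAction.sum (map g (map (x ,_) ys)) + ListAction.sum (map g (cartesianProduct xs ys))
    ≡⟨ cong₂ _+_ (cong ListAction.sum (sym (map-∘ ys))) (sum-map-cartesianProduct g xs ys) ⟩
  ListAction.sum (map (λ y → g (x , y)) ys) + _ ∎
  where open ≡-Reasoning

sum-map-tabulate : ∀ {A : Set} {n} (g : A → ℕ) (h : Fin n → A) →
  ListAction.sum (map g (tabulate h)) ≡ ∑[ i < n ] g (h i)
sum-map-tabulate {n = zero}  g h = refl
sum-map-tabulate {n = suc n} g h = cong (g (h zero) +_) (sum-map-tabulate g (h ∘ suc))

sum-map-cells : ∀ {m n} (g : Cell m n → ℕ) →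
  ListAction.sum (map g (cells m n)) ≡ ∑[ r < m ] ∑[ c < n ] g (r , c)
sum-map-cells {m} {n} g = begin
  ListAction.sum (map g (cartesianProduct (allFin m) (allFin n)))
    ≡⟨ sum-map-cartesianProduct g (allFin m) (allFin n) ⟩
  ListAction.sum (map (λ r → ListAction.sum (map (λ c → g (r , c)) (allFin n))) (allFin m))
    ≡⟨ sum-map-tabulate (λ r → ListAction.sum (map (λ c → g (r , c)) (allFin n))) (λ r → r) ⟩
  ∑[ r < m ] ListAction.sum (map (λ c → g (r , c)) (allFin n))
    ≡⟨ sum-cong-≗ (λ r → sum-map-tabulate (λ c → g (r , c)) (λ c → c)) ⟩
  ∑[ r < m ] ∑[ c < n ] g (r , c) ∎
  where open ≡-Reasoning

adjacentPairCount : ∀ {m n} → Graph (Cell m n) → ℕ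
adjacentPairCount {m} {n} G =
  length (filter (λ p → adj G (proj₁ p) (proj₂ p) Bool.≟ true) (cartesianProduct (cells m n) (cells m n)))

pairsBetween : ∀ {m n} → (Cell m n → Cell m n → Bool) → Fin n → Fin n → ℕ
pairsBetween {m} A c c' = ∑[ r < m ] ∑[ r' < m ] 𝟙 (A (r , c) (r' , c'))

adjacentPairCount≡∑pairsBetween : ∀ {m n} (G : Graph (Cell m n)) →
  adjacentPairCount G ≡ ∑[ c < n ] ∑[ c' < n ] pairsBetween (adj G) c c'
adjacentPairCount≡∑pairsBetween {m} {n} G = begin
  adjacentPairCount G
    ≡⟨ length-filter≡sum-𝟙 (λ p → adj G (proj₁ p) (proj₂ p))
                           (cartesianProduct (cells m n) (cells m n)) ⟩
  ListAction.sum (map (λ p → 𝟙 (adj G (proj₁ p) (proj₂ p))) (cartesianProduct (cells m n) (cells m n)))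
    ≡⟨ sum-map-cartesianProduct _ (cells m n) (cells m n) ⟩
  ListAction.sum (map (λ u → ListAction.sum (map (λ v → 𝟙 (adj G u v)) (cells m n))) (cells m n))
    ≡⟨ sum-map-cells (λ u → ListAction.sum (map (λ v → 𝟙 (adj G u v)) (cells m n))) ⟩
  ∑[ r < m ] ∑[ c < n ] ListAction.sum (map (λ v → 𝟙 (adj G (r , c) v)) (cells m n))
    ≡⟨ sum-cong-≗ (λ r → sum-cong-≗ λ c → sum-map-cells (λ v → 𝟙 (adj G (r , c) v))) ⟩
  ∑[ r < m ] ∑[ c < n ] ∑[ r' < m ] ∑[ c' < n ] A r c r' c'
    ≡⟨ sum-cong-≗ (λ r → sum-cong-≗ λ c → ∑-comm (A r c)) ⟩
  ∑[ r < m ] ∑[ c < n ] ∑[ c' < n ] ∑[ r' < m ] A r c r' c'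
    ≡⟨ ∑-comm (λ r c → ∑[ c' < n ] ∑[ r' < m ] A r c r' c') ⟩
  ∑[ c < n ] ∑[ r < m ] ∑[ c' < n ] ∑[ r' < m ] A r c r' c'
    ≡⟨ sum-cong-≗ (λ c → ∑-comm (λ r c' → ∑[ r' < m ] A r c r' c')) ⟩
  ∑[ c < n ] ∑[ c' < n ] pairsBetween (adj G) c c' ∎
  where
  open ≡-Reasoning
  A : Fin m → Fin n → Fin m → Fin n → ℕ
  A r c r' c' = 𝟙 (adj G (r , c) (r' , c'))

next⁻¹ : ∀ {l a b} → a ≤ l → Next (suc l) a b → b ≡ suc a ⊎ (a ≡ l × b ≡ 0)
next⁻¹ {l} a≤l a→b with m≤n⇒m<n∨m≡n a≤l
... | inj₁ a<l  = inj₁ (trans (sym a→b) (m<n⇒m%n≡m (s≤s a<l)))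
... | inj₂ refl = inj₂ (refl , trans (sym a→b) (n%n≡0 (suc l)))

¬next : ∀ {l a b} → a ≤ l → b ≢ suc a → (a ≡ l → b ≢ 0) → ¬ Next (suc l) a b
¬next a≤l b≢1+a wraps a→b with next⁻¹ a≤l a→b
... | inj₁ b≡1+a         = b≢1+a b≡1+a
... | inj₂ (a≡l , b≡0) = wraps a≡l b≡0

ChordAround : ℕ → ℕ → ℕ → ℕ → Set
ChordAround k i p q = Next L p i × Next L i q × p ≢ q × ¬ Next L p q × ¬ Next L q p
  where L = 4 + k

chordAround : ∀ k i → i < 4 + k → ∃₂ λ p q → p < 4 + k × q < 4 + k × ChordAround k i p q
chordAround k zero _ =
  3 + k , 1 , ≤-refl , s≤s (s≤s z≤n) ,
  n%n≡0 (4 + k) , refl , (λ ()) , ¬next {3 + k} ≤-refl (λ ()) (λ _ ()) , (λ ())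
chordAround k (suc j) i<L with m≤n⇒m<n∨m≡n i<L
... | inj₁ 2+j<L =
  j , 2 + j , ≤-trans (n≤1+n (suc j)) i<L , 2+j<L ,
  m<n⇒m%n≡m i<L , m<n⇒m%n≡m 2+j<L , m≢1+n+m j {1} ,
  ¬next {3 + k} (≤-trans (n≤1+n j) (≤-pred i<L)) 1+n≢n (λ _ ()) ,
  ¬next {3 + k} (≤-pred 2+j<L) (m≢1+n+m j {2}) (λ { () refl })
... | inj₂ refl =
  2 + k , 0 , n≤1+n (3 + k) , s≤s z≤n ,
  m<n⇒m%n≡m ≤-refl , n%n≡0 (4 + k) , (λ ()) ,
  ¬next {3 + k} (n≤1+n (2 + k)) (λ ()) (λ 2+k≡3+k → contradiction (sym 2+k≡3+k) 1+n≢n) , (λ ())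

chordAroundFin : ∀ k (i : Fin (4 + k)) → ∃₂ λ p q → ChordAround k (toℕ i) (toℕ p) (toℕ q)
chordAroundFin k i with chordAround k (toℕ i) (toℕ<n i)
... | p , q , p<L , q<L , around =
  fromℕ< p<L , fromℕ< q<L ,
  subst₂ (ChordAround k (toℕ i)) (sym (toℕ-fromℕ< p<L)) (sym (toℕ-fromℕ< q<L)) around

argminFin : ∀ {L} (f : Fin (suc L) → ℕ) → ∃[ i ] (∀ j → f i ≤ f j)
argminFin {L} f =
  argmin f zero (allFin (suc L)) ,
  λ j → All.lookup (f[argmin]≤f[xs] {f = f} zero (allFin (suc L))) (∈-allFin j)

IsPerfectEliminationKey : ∀ {V} → Graph V → (V → ℕ) → Set
IsPerfectEliminationKey {V} H key =
  ∀ u x y → key u ≤ key x → key u ≤ key y → x ≢ y →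
  adj H u x ≡ true → adj H u y ≡ true → adj H x y ≡ true

-- The two cycle neighbours of a vertex of minimal key are joined by a chord.
perfectEliminationKey⇒chordal : ∀ {V} (H : Graph V) (key : V → ℕ) →
  IsPerfectEliminationKey H key → Chordal H
perfectEliminationKey⇒chordal H key peo k C =
  let i , i-min = argminFin (key ∘ vert C)
      p , q , p→i , i→q , p≢q , ¬p→q , ¬q→p = chordAroundFin k i
  in p , q , p≢q ∘ cong toℕ , ¬p→q , ¬q→p ,
     peo (vert C i) (vert C p) (vert C q) (i-min p) (i-min q) (p≢q ∘ cong toℕ ∘ inj C)
         (trans (Graph.sym H (vert C i) (vert C p)) (edges C p i p→i)) (edges C i q i→q)

square⇒diagonal : ∀ {V} {H : Graph V} → Chordal H → (v : Fin 4 → V) → Injective _≡_ _≡_ v →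
  adj H (v 0F) (v 1F) ≡ true → adj H (v 1F) (v 2F) ≡ true →
  adj H (v 2F) (v 3F) ≡ true → adj H (v 3F) (v 0F) ≡ true →
  adj H (v 0F) (v 2F) ≡ true ⊎ adj H (v 1F) (v 3F) ≡ true
square⇒diagonal {H = H} chordal v v-injective e₀₁ e₁₂ e₂₃ e₃₀ = diagonal (chordal 0 square)
  where
  side : ∀ i j → Next 4 (toℕ i) (toℕ j) → adj H (v i) (v j) ≡ true
  side 0F 0F ()
  side 0F 1F _ = e₀₁
  side 0F 2F ()
  side 0F 3F ()
  side 1F 0F ()
  side 1F 1F ()
  side 1F 2F _ = e₁₂
  side 1F 3F ()
  side 2F 0F ()
  side 2F 1F ()
  side 2F 2F ()
  side 2F 3F _ = e₂₃
  side 3F 0F _ = e₃₀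
  side 3F 1F ()
  side 3F 2F ()
  side 3F 3F ()

  square : Cycle H 0
  vert square = v
  inj square = v-injective
  edges square = side

  flip : ∀ {x y} → adj H x y ≡ true → adj H y x ≡ true
  flip {x} {y} e = trans (Graph.sym H y x) e

  diagonal : HasChord square → adj H (v 0F) (v 2F) ≡ true ⊎ adj H (v 1F) (v 3F) ≡ true
  diagonal (0F , 0F , i≢j , _ , _ , _) = contradiction refl i≢j
  diagonal (0F , 1F , _ , ¬i→j , _ , _) = contradiction refl ¬i→j
  diagonal (0F , 2F , _ , _ , _ , e) = inj₁ e
  diagonal (0F , 3F , _ , _ , ¬j→i , _) = contradiction refl ¬j→i
  diagonal (1F , 0F , _ , _ , ¬j→i , _) = contradiction refl ¬j→i
  diagonal (1F , 1F , i≢j , _ , _ , _) = contradiction refl i≢j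
  diagonal (1F , 2F , _ , ¬i→j , _ , _) = contradiction refl ¬i→j
  diagonal (1F , 3F , _ , _ , _ , e) = inj₂ e
  diagonal (2F , 0F , _ , _ , _ , e) = inj₁ (flip e)
  diagonal (2F , 1F , _ , _ , ¬j→i , _) = contradiction refl ¬j→i
  diagonal (2F , 2F , i≢j , _ , _ , _) = contradiction refl i≢j
  diagonal (2F , 3F , _ , ¬i→j , _ , _) = contradiction refl ¬i→j
  diagonal (3F , 0F , _ , ¬i→j , _ , _) = contradiction refl ¬i→j
  diagonal (3F , 1F , _ , _ , _ , e) = inj₂ (flip e)
  diagonal (3F , 2F , _ , _ , ¬j→i , _) = contradiction refl ¬j→i
  diagonal (3F , 3F , i≢j , _ , _ , _) = contradiction refl i≢j

rook-adj-sameRow : ∀ {m n} (r : Fin m) (a b : Fin n) → adj (rook m n) (r , a) (r , b) ≡ not (does (a ≟ b))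
rook-adj-sameRow r a b rewrite dec-true (r ≟ r) refl = ∨-identityʳ _

rook-adj-otherRow : ∀ {m n} (r r' : Fin m) → r ≢ r' → (a b : Fin n) →
  adj (rook m n) (r , a) (r' , b) ≡ does (a ≟ b)
rook-adj-otherRow r r' r≢r' a b rewrite dec-false (r ≟ r') r≢r' = refl

rook-sameRow : ∀ {m n} (r : Fin m) {a b : Fin n} → a ≢ b → adj (rook m n) (r , a) (r , b) ≡ true
rook-sameRow r {a} {b} a≢b = trans (rook-adj-sameRow r a b) (cong not (dec-false (a ≟ b) a≢b))

rook-otherRow⇒sameColumn : ∀ {m n} (r r' : Fin m) → r ≢ r' → {a b : Fin n} →
  adj (rook m n) (r , a) (r' , b) ≡ true → a ≡ b
rook-otherRow⇒sameColumn r r' r≢r' {a} {b} e =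
  does≡true⇒ (a ≟ b) (trans (sym (rook-adj-otherRow r r' r≢r' a b)) e)

rook-sameColumn : ∀ {m n} (r r' : Fin m) → r ≢ r' → (c : Fin n) → adj (rook m n) (r , c) (r' , c) ≡ true
rook-sameColumn r r' r≢r' c = trans (rook-adj-otherRow r r' r≢r' c c) (dec-true (c ≟ c) refl)

triangulation-crossEdge : ∀ {n} {H : Graph (Cell 2 n)} → IsTriangulation (rook 2 n) H →
  ∀ {a b} → a ≢ b → adj H (0F , a) (1F , b) ≡ true ⊎ adj H (1F , a) (0F , b) ≡ true
triangulation-crossEdge {n} {H} (rook⊆H , chordal) {a} {b} a≢b =
  Sum.map₂ (trans (Graph.sym H (1F , a) (0F , b)))
    (square⇒diagonal chordal corner corner-injective
      (rook⊆H (0F , a) (0F , b) (rook-sameRow {2} 0F a≢b))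
      (rook⊆H (0F , b) (1F , b) (rook-sameColumn {2} 0F 1F (λ ()) b))
      (rook⊆H (1F , b) (1F , a) (rook-sameRow {2} 1F (a≢b ∘ sym)))
      (rook⊆H (1F , a) (0F , a) (rook-sameColumn {2} 1F 0F (λ ()) a)))
  where
  corner : Fin 4 → Cell 2 n
  corner 0F = 0F , a
  corner 1F = 0F , b
  corner 2F = 1F , b
  corner 3F = 1F , a

  cornerIndex : Cell 2 n → Fin 4
  cornerIndex (0F , c) = if does (c ≟ a) then 0F else 1F
  cornerIndex (1F , c) = if does (c ≟ a) then 3F else 2F

  cornerIndex-corner : ∀ i → cornerIndex (corner i) ≡ i
  cornerIndex-corner 0F rewrite dec-true (a ≟ a) refl = refl
  cornerIndex-corner 1F rewrite dec-false (b ≟ a) (a≢b ∘ sym) = refl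
  cornerIndex-corner 2F rewrite dec-false (b ≟ a) (a≢b ∘ sym) = refl
  cornerIndex-corner 3F rewrite dec-true (a ≟ a) refl = refl

  corner-injective : Injective _≡_ _≡_ corner
  corner-injective {i} {j} e =
    trans (sym (cornerIndex-corner i)) (trans (cong cornerIndex e) (cornerIndex-corner j))

staircaseAdj : ∀ {n} → Cell 2 n → Cell 2 n → Bool
staircaseAdj (0F , a) (0F , b) = not (does (a ≟ b))
staircaseAdj (0F , a) (1F , b) = does (a ≤? b)
staircaseAdj (1F , a) (0F , b) = does (b ≤? a)
staircaseAdj (1F , a) (1F , b) = not (does (a ≟ b))

staircaseAdj-sym : ∀ {n} (u v : Cell 2 n) → staircaseAdj u v ≡ staircaseAdj v u
staircaseAdj-sym (0F , a) (0F , b) = cong not (does-≟-comm a b)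
staircaseAdj-sym (0F , a) (1F , b) = refl
staircaseAdj-sym (1F , a) (0F , b) = refl
staircaseAdj-sym (1F , a) (1F , b) = cong not (does-≟-comm a b)

staircaseAdj-irrefl : ∀ {n} (u : Cell 2 n) → staircaseAdj u u ≡ false
staircaseAdj-irrefl (0F , a) = cong not (dec-true (a ≟ a) refl)
staircaseAdj-irrefl (1F , a) = cong not (dec-true (a ≟ a) refl)

staircase : ∀ n → Graph (Cell 2 n)
adj       (staircase n) = staircaseAdj
Graph.sym (staircase n) = staircaseAdj-sym
irrefl    (staircase n) = staircaseAdj-irrefl

rook⊆staircase : ∀ {n} (u v : Cell 2 n) → adj (rook 2 n) u v ≡ true → staircaseAdj u v ≡ true
rook⊆staircase (0F , a) (0F , b) e = trans (sym (rook-adj-sameRow {2} 0F a b)) e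
rook⊆staircase (0F , a) (1F , b) e =
  dec-true (a ≤? b) (Fin.≤-reflexive (rook-otherRow⇒sameColumn {2} 0F 1F (λ ()) e))
rook⊆staircase (1F , a) (0F , b) e =
  dec-true (b ≤? a) (Fin.≤-reflexive (sym (rook-otherRow⇒sameColumn {2} 1F 0F (λ ()) e)))
rook⊆staircase (1F , a) (1F , b) e = trans (sym (rook-adj-sameRow {2} 1F a b)) e

staircase-sameRow : ∀ {n} (r : Fin 2) {a b : Fin n} → (r , a) ≢ (r , b) → staircaseAdj (r , a) (r , b) ≡ true
staircase-sameRow 0F {a} {b} ne = cong not (dec-false (a ≟ b) (ne ∘ cong (0F ,_)))
staircase-sameRow 1F {a} {b} ne = cong not (dec-false (a ≟ b) (ne ∘ cong (1F ,_)))

eliminationKey : ∀ {n} → Cell 2 n → ℕ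
eliminationKey {n} (0F , a) = n + toℕ a
eliminationKey     (1F , b) = toℕ b

eliminationKey-rowOne<rowZero : ∀ {n} (a b : Fin n) → eliminationKey (1F , b) < eliminationKey (0F , a)
eliminationKey-rowOne<rowZero {n} a b = <-≤-trans (toℕ<n b) (m≤m+n n (toℕ a))

staircase-perfectEliminationKey : ∀ n → IsPerfectEliminationKey (staircase n) eliminationKey
staircase-perfectEliminationKey n (0F , _) (0F , _) (0F , _) _ _ x≢y _ _ = staircase-sameRow 0F x≢y
staircase-perfectEliminationKey n (0F , a) (1F , b) _ kx _ _ _ _ =
  contradiction kx (<⇒≱ (eliminationKey-rowOne<rowZero a b))
staircase-perfectEliminationKey n (0F , a) (0F , _) (1F , b) _ ky _ _ _ =
  contradiction ky (<⇒≱ (eliminationKey-rowOne<rowZero a b))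
staircase-perfectEliminationKey n (1F , _) (0F , _) (0F , _) _ _ x≢y _ _ = staircase-sameRow 0F x≢y
staircase-perfectEliminationKey n (1F , _) (1F , _) (1F , _) _ _ x≢y _ _ = staircase-sameRow 1F x≢y
staircase-perfectEliminationKey n (1F , b) (0F , a) (1F , b') _ ky _ ux _ =
  dec-true (a ≤? b') (≤-trans (does≡true⇒ (a ≤? b) ux) ky)
staircase-perfectEliminationKey n (1F , b) (1F , b') (0F , a) kx _ _ _ uy =
  dec-true (a ≤? b') (≤-trans (does≡true⇒ (a ≤? b) uy) kx)

staircase-triangulates : ∀ n → IsTriangulation (rook 2 n) (staircase n)
staircase-triangulates n =
  rook⊆staircase , perfectEliminationKey⇒chordal (staircase n) eliminationKey (staircase-perfectEliminationKey n)

offDiagonal : ∀ {n} → Fin n → Fin n → ℕ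
offDiagonal c c' = 𝟙 (not (does (c ≟ c')))

∑-offDiagonal : ∀ {n} (c : Fin n) → ∑[ c' < n ] offDiagonal c c' ≡ n ∸ 1
∑-offDiagonal {suc n}       zero    = trans (∑-const n 1) (*-identityʳ n)
∑-offDiagonal {suc (suc n)} (suc c) = cong suc (∑-offDiagonal c)

∑∑-2+offDiagonal : ∀ n → ∑[ c < n ] ∑[ c' < n ] (2 + offDiagonal c c') ≡ n * n * 2 + n * (n ∸ 1)
∑∑-2+offDiagonal n = begin
  ∑[ c < n ] ∑[ c' < n ] (2 + offDiagonal c c')
    ≡⟨ sum-cong-≗ {n} (λ c → ∑-distrib-+ (λ _ → 2) (offDiagonal c)) ⟩
  ∑[ c < n ] (∑[ c' < n ] 2 + ∑[ c' < n ] offDiagonal c c')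
    ≡⟨ sum-cong-≗ {n} (λ c → cong₂ _+_ (∑-const n 2) (∑-offDiagonal c)) ⟩
  ∑[ c < n ] (n * 2 + (n ∸ 1))
    ≡⟨ ∑-const n (n * 2 + (n ∸ 1)) ⟩
  n * (n * 2 + (n ∸ 1))
    ≡⟨ *-distribˡ-+ n (n * 2) (n ∸ 1) ⟩
  n * (n * 2) + n * (n ∸ 1)
    ≡⟨ cong (_+ n * (n ∸ 1)) (sym (*-assoc n n 2)) ⟩
  n * n * 2 + n * (n ∸ 1) ∎
  where open ≡-Reasoning

rook-pairsBetween : ∀ {n} (c c' : Fin n) → pairsBetween (adj (rook 2 n)) c c' ≡ 2
rook-pairsBetween c c' with c ≟ c'
... | yes _ = refl
... | no _  = refl

staircase-pairsBetween : ∀ {n} (c c' : Fin n) →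
  pairsBetween (adj (staircase n)) c c' ≡ 2 + offDiagonal c c'
staircase-pairsBetween c c' with Fin.<-cmp c c'
... | tri< c<c' _ _
  rewrite dec-false (c ≟ c') (Fin.<⇒≢ c<c') | dec-true (c ≤? c') (<⇒≤ c<c')
        | dec-false (c' ≤? c) (<⇒≱ c<c')
  = refl
... | tri≈ _ refl _
  rewrite dec-true (c ≟ c) refl | dec-true (c ≤? c) ≤-refl
  = refl
... | tri> _ _ c'<c
  rewrite dec-false (c ≟ c') (Fin.<⇒≢ c'<c ∘ sym) | dec-false (c ≤? c') (<⇒≱ c'<c)
        | dec-true (c' ≤? c) (<⇒≤ c'<c)
  = refl

triangulation-pairsBetween-≥ : ∀ {n} {H : Graph (Cell 2 n)} → IsTriangulation (rook 2 n) H →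
  ∀ c c' → 2 + offDiagonal c c' ≤ pairsBetween (adj H) c c'
triangulation-pairsBetween-≥ {n} {H} T@(rook⊆H , _) c c' with c ≟ c'
... | yes refl
  rewrite irrefl H (0F , c) | irrefl H (1F , c)
        | rook⊆H (0F , c) (1F , c) (rook-sameColumn {2} 0F 1F (λ ()) c)
        | rook⊆H (1F , c) (0F , c) (rook-sameColumn {2} 1F 0F (λ ()) c)
  = ≤-refl
... | no c≢c'
  with adj H (0F , c) (0F , c') | rook⊆H (0F , c) (0F , c') (rook-sameRow {2} 0F c≢c')
     | adj H (1F , c) (1F , c') | rook⊆H (1F , c) (1F , c') (rook-sameRow {2} 1F c≢c')
     | adj H (0F , c) (1F , c') | adj H (1F , c) (0F , c') | triangulation-crossEdge T c≢c'
... | _ | refl | _ | refl | true  | true  | _       = s≤s (s≤s (s≤s z≤n))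
... | _ | refl | _ | refl | true  | false | _       = s≤s (s≤s (s≤s z≤n))
... | _ | refl | _ | refl | false | true  | _       = s≤s (s≤s (s≤s z≤n))
... | _ | refl | _ | refl | false | false | inj₁ ()
... | _ | refl | _ | refl | false | false | inj₂ ()

rook-adjacentPairCount : ∀ n → adjacentPairCount (rook 2 n) ≡ n * n * 2
rook-adjacentPairCount n = begin
  adjacentPairCount (rook 2 n)                 ≡⟨ adjacentPairCount≡∑pairsBetween (rook 2 n) ⟩
  ∑[ c < n ] ∑[ c' < n ] pairsBetween (adj (rook 2 n)) c c'
    ≡⟨ sum-cong-≗ {n} (λ c → sum-cong-≗ {n} (rook-pairsBetween c)) ⟩
  ∑[ c < n ] ∑[ c' < n ] 2                     ≡⟨ sum-cong-≗ {n} (λ _ → ∑-const n 2) ⟩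
  ∑[ c < n ] (n * 2)                           ≡⟨ ∑-const n (n * 2) ⟩
  n * (n * 2)                                  ≡⟨ *-assoc n n 2 ⟨
  n * n * 2                                    ∎
  where open ≡-Reasoning

staircase-adjacentPairCount : ∀ n → adjacentPairCount (staircase n) ≡ n * n * 2 + n * (n ∸ 1)
staircase-adjacentPairCount n = begin
  adjacentPairCount (staircase n)              ≡⟨ adjacentPairCount≡∑pairsBetween (staircase n) ⟩
  ∑[ c < n ] ∑[ c' < n ] pairsBetween (adj (staircase n)) c c'
    ≡⟨ sum-cong-≗ {n} (λ c → sum-cong-≗ {n} (staircase-pairsBetween c)) ⟩
  ∑[ c < n ] ∑[ c' < n ] (2 + offDiagonal c c') ≡⟨ ∑∑-2+offDiagonal n ⟩
  n * n * 2 + n * (n ∸ 1)                      ∎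
  where open ≡-Reasoning

triangulation-adjacentPairCount-≥ : ∀ {n} {H : Graph (Cell 2 n)} → IsTriangulation (rook 2 n) H →
  n * n * 2 + n * (n ∸ 1) ≤ adjacentPairCount H
triangulation-adjacentPairCount-≥ {n} {H} T = begin
  n * n * 2 + n * (n ∸ 1)                       ≡⟨ ∑∑-2+offDiagonal n ⟨
  ∑[ c < n ] ∑[ c' < n ] (2 + offDiagonal c c')
    ≤⟨ ∑-mono-≤ (λ c → ∑-mono-≤ (triangulation-pairsBetween-≥ T c)) ⟩
  ∑[ c < n ] ∑[ c' < n ] pairsBetween (adj H) c c' ≡⟨ adjacentPairCount≡∑pairsBetween H ⟨
  adjacentPairCount H                           ∎
  where open ≤-Reasoning

rook-edgeCount : ∀ n → edgeCount (rook 2 n) ≡ n * n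
rook-edgeCount n = trans (cong (_/ 2) (rook-adjacentPairCount n)) (m*n/n≡m (n * n) 2)

staircase-edgeCount : ∀ n → edgeCount (staircase n) ≡ n * n + n * (n ∸ 1) / 2
staircase-edgeCount n =
  trans (cong (_/ 2) (staircase-adjacentPairCount n)) ([m*2+n]/2≡m+n/2 (n * n) (n * (n ∸ 1)))

triangulation-edgeCount-≥ : ∀ {n} {H : Graph (Cell 2 n)} → IsTriangulation (rook 2 n) H →
  n * n + n * (n ∸ 1) / 2 ≤ edgeCount H
triangulation-edgeCount-≥ {n} {H} T = begin
  n * n + n * (n ∸ 1) / 2       ≡⟨ [m*2+n]/2≡m+n/2 (n * n) (n * (n ∸ 1)) ⟨
  (n * n * 2 + n * (n ∸ 1)) / 2 ≤⟨ /-monoˡ-≤ 2 (triangulation-adjacentPairCount-≥ T) ⟩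
  edgeCount H                   ∎
  where open ≤-Reasoning

rook₂-minFillIn : ∀ n → MinFillIn (rook 2 n) (n * (n ∸ 1) / 2)
rook₂-minFillIn n = (staircase n , staircase-triangulates n , staircase-fill) , triangulation-fill-≥
  where
  open ≤-Reasoning
  staircase-fill : fill (rook 2 n) (staircase n) ≡ n * (n ∸ 1) / 2
  staircase-fill = trans (cong₂ _∸_ (staircase-edgeCount n) (rook-edgeCount n)) (m+n∸m≡n (n * n) _)

  triangulation-fill-≥ : ∀ H → IsTriangulation (rook 2 n) H → n * (n ∸ 1) / 2 ≤ fill (rook 2 n) H
  triangulation-fill-≥ H T = begin
    n * (n ∸ 1) / 2                   ≡⟨ m+n∸m≡n (n * n) _ ⟨
    n * n + n * (n ∸ 1) / 2 ∸ n * n   ≤⟨ ∸-monoˡ-≤ (n * n) (triangulation-edgeCount-≥ T) ⟩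
    edgeCount H ∸ n * n               ≡⟨ cong (edgeCount H ∸_) (rook-edgeCount n) ⟨
    fill (rook 2 n) H                 ∎

mainTheorem5 : (n : ℕ) → 2 ≤ n → MinFillIn (rook 2 n) ((n * (n ∸ 1)) / 2)
mainTheorem5 n _ = rook₂-minFillIn n
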